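{- The family $\mathcal{F}=\{M_1,\ldots,M_{13}\}\cup\{S_1,\ldots,S_{15}\}$ is admissible.
   Context: All polynomials are in $\mathbb{F}_2[x]$; $\sigma(A)$ is the sum of all divisors of $A$. $\overline{T}(x):=T(x+1)$, $T^*(x):=x^{\deg T}T(1/x)$. For $Q$ and positive integers $a,b,c$, $Q^{abc}:=1+x^a(x+1)^bQ^c$. $M_1=1+x+x^2$, $M_2=1+x+x^3$, $M_3=1+x^2+x^3$, $M_4=1+x+x^2+x^3+x^4$, $M_5=1+x^3+x^4$, $M_6=1+x^3+x^5$, $M_7=1+x^3+x^7$, $M_8=1+x^6+x^7$, $M_9=\overline{M_6}$, $M_{10}=\overline{M_7}$, $M_{11}=\overline{M_8}$, $M_{12}=x^9+x+1$, $M_{13}=x^9+x^8+1$; $S_1=M_1^{111}$, $S_2=M_1^{221}$, $S_3=M_1^{134}$, $S_4=M_1^{311}$, $S_5=M_1^{131}$, $S_6=M_1^{314}$, $S_7=M_1^{113}$, $S_8=M_1^{331}$, $S_9=M_1^{115}$, $S_{10}=M_1^{411}$, $S_{11}=M_1^{121}$, $S_{12}=M_1^{212}$, $S_{13}=M_1^{141}$, $S_{14}=M_1^{211}$, $S_{15}=M_1^{122}$. A polynomial "factors in" a family $\mathcal{G}$ if all its irreducible factors belong to $\mathcal{G}$. A family $\mathcal{G}$ of odd (no linear factor) irreducible polynomials is admissible if it satisfies at least one of: (i) for every $T\in\mathcal{G}$, $T^*\in\mathcal{G}$ or $\overline{T}\in\mathcal{G}$; (ii) there exists a positive integer $h$ such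 that $\sigma(x^{2h})$ or $\sigma((x+1)^{2h})$ factors in $\mathcal{G}$; (iii) for every $T\in\mathcal{G}$, $1+T$ or $\sigma(T^{2h})$ (for some positive integer $h$) factors in $\mathcal{G}\cup\{x,x+1\}$. -}

module Defs where

open import Data.Bool using (Bool; true; false; _xor_; _∧_; _∨_; if_then_else_; not)
open import Data.Nat using (ℕ; zero; suc; _+_; _*_; _≤_; _≥_; _≡ᵇ_)
open import Data.List using (List; []; _∷_; foldr; reverse; length; replicate; map)
open import Data.List.Relation.Unary.All using (All)
open import Data.List.Relation.Unary.Any using (Any)
open import Data.Product using (Σ; ∃; _×_; _,_)
open import Data.Sum using (_⊎_)
open import Relation.Binary.PropositionalEquality using (_≡_)
open import Relation.Nullary using (¬_)

-- Polynomials over F₂ as coefficient lists, lowest degree first.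
-- A list may have trailing zero coefficients; polynomial equality is
-- equality after normalisation (stripping trailing zeros).

Poly : Set
Poly = List Bool

norm : Poly → Poly
norm [] = []
norm (b ∷ p) with norm p
... | [] = if b then true ∷ [] else []
... | q@(_ ∷ _) = b ∷ q

_≈_ : Poly → Poly → Set
p ≈ q = norm p ≡ norm q

infix 4 _≈_

-- degree (the zero polynomial gets degree 0; it never matters below)
deg : Poly → ℕ
deg p with norm p
... | [] = 0
... | (_ ∷ q) = length q

_⊕_ : Poly → Poly → Poly
[] ⊕ q = q
(a ∷ p) ⊕ [] = a ∷ p
(a ∷ p) ⊕ (b ∷ q) = (a xor b) ∷ (p ⊕ q)

infixl 6 _⊕_

scale : Bool → Poly → Poly
scale b p = map (λ c → b ∧ c) p

_⊗_ : Poly → Poly → Poly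
[] ⊗ q = []
(a ∷ p) ⊗ q = scale a q ⊕ (false ∷ (p ⊗ q))

infixl 7 _⊗_

one : Poly
one = true ∷ []

X : Poly
X = false ∷ true ∷ []

X1 : Poly
X1 = true ∷ true ∷ []

_^ᵖ_ : Poly → ℕ → Poly
p ^ᵖ zero = one
p ^ᵖ suc n = p ⊗ (p ^ᵖ n)

infixr 8 _^ᵖ_

mono : ℕ → Poly
mono n = replicate n false Data.List.++ (true ∷ [])

fromExps : List ℕ → Poly
fromExps = foldr (λ n acc → mono n ⊕ acc) []

-- T̄(x) = T(x+1)  (Horner evaluation at x+1)
bar : Poly → Poly
bar = foldr (λ c acc → (c ∷ []) ⊕ X1 ⊗ acc) []

-- T*(x) = x^{deg T} T(1/x): reversal of the (normalised) coefficient list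
rec* : Poly → Poly
rec* p = reverse (norm p)

_∣_ : Poly → Poly → Set
D ∣ A = Σ Poly (λ Q → D ⊗ Q ≈ A)

infix 4 _∣_

-- P is irreducible: non-constant and every divisor is a unit (degree 0,
-- necessarily the polynomial 1) or an associate (degree deg P).
Irreducible : Poly → Set
Irreducible P = (1 ≤ deg P) × (∀ D → D ∣ P → (deg D ≡ 0) ⊎ (deg D ≡ deg P))

Odd : Poly → Set
Odd P = (¬ (X ∣ P)) × (¬ (X1 ∣ P))

-- σ(A): sum of all (monic = nonzero) divisors of A.
-- Every divisor of a nonzero A has degree ≤ deg A, so it occurs among
-- the 2^(deg A + 1) coefficient lists of length deg A + 1 (allLists n = all lists of length n); each
-- polynomial occurs exactly once in that enumeration (up to ≈).

allLists : ℕ → List Poly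
allLists zero = [] ∷ []
allLists (suc n) = map (false ∷_) (allLists n) Data.List.++ map (true ∷_) (allLists n)

eqᵖ : Poly → Poly → Bool
eqᵖ p q = eqL (norm p) (norm q)
  where
  eqB : Bool → Bool → Bool
  eqB a b = not (a xor b)
  eqL : List Bool → List Bool → Bool
  eqL [] [] = true
  eqL [] (_ ∷ _) = false
  eqL (_ ∷ _) [] = false
  eqL (a ∷ p) (b ∷ q) = eqB a b ∧ eqL p q

isZero : Poly → Bool
isZero p = eqᵖ p []

anyᵇ : (Poly → Bool) → List Poly → Bool
anyᵇ f [] = false
anyᵇ f (x ∷ xs) = f x ∨ anyᵇ f xs

filterᵇ : (Poly → Bool) → List Poly → List Poly
filterᵇ f [] = []
filterᵇ f (x ∷ xs) = if f x then x ∷ filterᵇ f xs else filterᵇ f xs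

divides? : Poly → Poly → Bool
divides? D A = anyᵇ (λ Q → eqᵖ (D ⊗ Q) A) (allLists (suc (deg A)))

sumᵖ : List Poly → Poly
sumᵖ = foldr _⊕_ []

σ : Poly → Poly
σ A = sumᵖ (filterᵇ (λ D → not (isZero D) ∧ divides? D A) (allLists (suc (deg A))))

Family : Set
Family = List Poly

_∈ᶠ_ : Poly → Family → Set
P ∈ᶠ G = Any (λ Q → P ≈ Q) G

FactorsIn : Family → Poly → Set
FactorsIn G A = ∀ P → Irreducible P → P ∣ A → P ∈ᶠ G

CondI : Family → Set
CondI G = All (λ T → (rec* T ∈ᶠ G) ⊎ (bar T ∈ᶠ G)) G

CondII : Family → Set
CondII G = Σ ℕ (λ h → (1 ≤ h) × (FactorsIn G (σ (X ^ᵖ (2 * h))) ⊎ FactorsIn G (σ (X1 ^ᵖ (2 * h)))))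

CondIII : Family → Set
CondIII G = All (λ T → FactorsIn (X ∷ X1 ∷ G) (one ⊕ T)
                       ⊎ Σ ℕ (λ h → (1 ≤ h) × FactorsIn (X ∷ X1 ∷ G) (σ (T ^ᵖ (2 * h))))) G

Admissible : Family → Set
Admissible G = All (λ T → Irreducible T × Odd T) G × (CondI G ⊎ CondII G ⊎ CondIII G)

Qabc : Poly → ℕ → ℕ → ℕ → Poly
Qabc Q a b c = one ⊕ (X ^ᵖ a) ⊗ (X1 ^ᵖ b) ⊗ (Q ^ᵖ c)

M1 M2 M3 M4 M5 M6 M7 M8 M9 M10 M11 M12 M13 : Poly
M1 = fromExps (0 ∷ 1 ∷ 2 ∷ [])
M2 = fromExps (0 ∷ 1 ∷ 3 ∷ [])
M3 = fromExps (0 ∷ 2 ∷ 3 ∷ [])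
M4 = fromExps (0 ∷ 1 ∷ 2 ∷ 3 ∷ 4 ∷ [])
M5 = fromExps (0 ∷ 3 ∷ 4 ∷ [])
M6 = fromExps (0 ∷ 3 ∷ 5 ∷ [])
M7 = fromExps (0 ∷ 3 ∷ 7 ∷ [])
M8 = fromExps (0 ∷ 6 ∷ 7 ∷ [])
M9 = bar M6
M10 = bar M7
M11 = bar M8
M12 = fromExps (9 ∷ 1 ∷ 0 ∷ [])
M13 = fromExps (9 ∷ 8 ∷ 0 ∷ [])

S1 S2 S3 S4 S5 S6 S7 S8 S9 S10 S11 S12 S13 S14 S15 : Poly
S1 = Qabc M1 1 1 1
S2 = Qabc M1 2 2 1
S3 = Qabc M1 1 3 4
S4 = Qabc M1 3 1 1
S5 = Qabc M1 1 3 1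
S6 = Qabc M1 3 1 4
S7 = Qabc M1 1 1 3
S8 = Qabc M1 3 3 1
S9 = Qabc M1 1 1 5
S10 = Qabc M1 4 1 1
S11 = Qabc M1 1 2 1
S12 = Qabc M1 2 1 2
S13 = Qabc M1 1 4 1
S14 = Qabc M1 2 1 1
S15 = Qabc M1 1 2 2

𝓕 : Family
𝓕 = M1 ∷ M2 ∷ M3 ∷ M4 ∷ M5 ∷ M6 ∷ M7 ∷ M8 ∷ M9 ∷ M10 ∷ M11 ∷ M12 ∷ M13
  ∷ S1 ∷ S2 ∷ S3 ∷ S4 ∷ S5 ∷ S6 ∷ S7 ∷ S8 ∷ S9 ∷ S10 ∷ S11 ∷ S12 ∷ S13 ∷ S14 ∷ S15 ∷ []

module Submission where

-- Irreducibility of P is certified by exhaustive search: an irreducible P of degree n has no monic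
-- factor of degree 1 … ⌊n/2⌋, because in any factorisation D·Q = P the degrees add up to n, so the
-- smaller factor has degree at most ⌊n/2⌋.  A monic Z = x^k + c(x) is excluded as a factor by
-- computing P in the F₂[x]-module F₂[x]/(Z) ≅ F₂^k, where x acts as the companion matrix of Z:
-- Z ∣ P forces P ↦ 0 there, on whichever side of the product Z stands.  Oddness is the same
-- computation modulo x and x + 1, and condition (i) is checked by computing T* and T̄ directly.

open import Defs
open import Algebra using (CommutativeRing)
open import Data.Bool using (Bool; true; false; _xor_; if_then_else_)
open import Data.Bool.Properties using (xor-∧-commutativeRing; xor-comm; xor-same; xor-identityʳ)
import Data.Bool as Bool
open import Data.Nat using (ℕ; zero; suc; _+_; _∸_; _≤_; _<_; z≤n; s≤s; ⌊_/2⌋)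
open import Data.Nat.Properties
  using (≤-total; +-identityʳ; +-comm; +-monoʳ-≤; suc-injective; n<1⇒n≡0; m≤n+m; _≤?_; allUpTo?;
         n≮0; m+n∸n≡m; ⌊n/2⌋-mono; n≡⌊n+n/2⌋)
open import Data.List using (List; []; _∷_; length; _∷ʳ_)
open import Data.List.Properties using (length-++; map-id)
import Data.List.Properties as List
open import Data.List.Relation.Unary.All as All using (all?)
open import Data.List.Relation.Unary.Any using (any?)
open import Data.Vec using (Vec; []; _∷_; toList; fromList)
open import Data.Vec.Properties using (toList∘fromList)
import Data.Vec.Properties as Vec
open import Data.Product using (∃; _×_; _,_; proj₁; proj₂)
open import Data.Sum using (_⊎_; inj₁; inj₂)
open import Data.Empty using (⊥-elim)
open import Function using (_∘_)
open import Relation.Nullary using (¬_; Dec)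
open import Relation.Nullary.Decidable using (from-yes; _⊎-dec_; _×-dec_; ¬?; map′)
open import Relation.Binary.PropositionalEquality
  using (_≡_; _≢_; refl; sym; trans; cong; cong₂; subst; subst₂; module ≡-Reasoning)
open import Algebra.Properties.CommutativeSemigroup
  (CommutativeRing.+-commutativeSemigroup xor-∧-commutativeRing)
  using () renaming (interchange to xor-interchange)

private
  variable
    k n : ℕ

infixl 6 _+ᵛ_
infixr 7 _*ᵛ_

_+ᵛ_ : Vec Bool k → Vec Bool k → Vec Bool k
[] +ᵛ [] = []
(a ∷ u) +ᵛ (b ∷ v) = (a xor b) ∷ (u +ᵛ v)

0ᵛ : Vec Bool k
0ᵛ {zero} = []
0ᵛ {suc k} = false ∷ 0ᵛ

_*ᵛ_ : Bool → Vec Bool k → Vec Bool k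
true *ᵛ u = u
false *ᵛ u = 0ᵛ

+ᵛ-identityˡ : (u : Vec Bool k) → 0ᵛ +ᵛ u ≡ u
+ᵛ-identityˡ [] = refl
+ᵛ-identityˡ (a ∷ u) = cong (a ∷_) (+ᵛ-identityˡ u)

+ᵛ-identityʳ : (u : Vec Bool k) → u +ᵛ 0ᵛ ≡ u
+ᵛ-identityʳ [] = refl
+ᵛ-identityʳ (a ∷ u) = cong₂ _∷_ (xor-identityʳ a) (+ᵛ-identityʳ u)

+ᵛ-self : (u : Vec Bool k) → u +ᵛ u ≡ 0ᵛ
+ᵛ-self [] = refl
+ᵛ-self (a ∷ u) = cong₂ _∷_ (xor-same a) (+ᵛ-self u)

+ᵛ-interchange : (u v w z : Vec Bool k) → (u +ᵛ v) +ᵛ (w +ᵛ z) ≡ (u +ᵛ w) +ᵛ (v +ᵛ z)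
+ᵛ-interchange [] [] [] [] = refl
+ᵛ-interchange (a ∷ u) (b ∷ v) (c ∷ w) (d ∷ z) =
  cong₂ _∷_ (xor-interchange a b c d) (+ᵛ-interchange u v w z)

0ᵛ+ᵛ0ᵛ : 0ᵛ {k} +ᵛ 0ᵛ ≡ 0ᵛ
0ᵛ+ᵛ0ᵛ = +ᵛ-identityˡ 0ᵛ

*ᵛ-zeroʳ : ∀ a → a *ᵛ 0ᵛ {k} ≡ 0ᵛ
*ᵛ-zeroʳ true = refl
*ᵛ-zeroʳ false = refl

*ᵛ-distribˡ-+ᵛ : ∀ a (u v : Vec Bool k) → a *ᵛ (u +ᵛ v) ≡ a *ᵛ u +ᵛ a *ᵛ v
*ᵛ-distribˡ-+ᵛ true u v = refl
*ᵛ-distribˡ-+ᵛ false u v = sym 0ᵛ+ᵛ0ᵛ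

*ᵛ-distribʳ-xor : ∀ a b (u : Vec Bool k) → (a xor b) *ᵛ u ≡ a *ᵛ u +ᵛ b *ᵛ u
*ᵛ-distribʳ-xor true true u = sym (+ᵛ-self u)
*ᵛ-distribʳ-xor true false u = sym (+ᵛ-identityʳ u)
*ᵛ-distribʳ-xor false true u = sym (+ᵛ-identityˡ u)
*ᵛ-distribʳ-xor false false u = sym 0ᵛ+ᵛ0ᵛ

-- shiftIn c u and carry c u are the first k and the last entry of c ∷ u.
shiftIn : Bool → Vec Bool k → Vec Bool k
shiftIn c [] = []
shiftIn c (a ∷ u) = c ∷ shiftIn a u

carry : Bool → Vec Bool k → Bool
carry c [] = c
carry c (a ∷ u) = carry a u

shiftIn-+ᵛ : ∀ c d (u v : Vec Bool k) → shiftIn (c xor d) (u +ᵛ v) ≡ shiftIn c u +ᵛ shiftIn d v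
shiftIn-+ᵛ c d [] [] = refl
shiftIn-+ᵛ c d (a ∷ u) (b ∷ v) = cong ((c xor d) ∷_) (shiftIn-+ᵛ a b u v)

carry-+ᵛ : ∀ c d (u v : Vec Bool k) → carry (c xor d) (u +ᵛ v) ≡ carry c u xor carry d v
carry-+ᵛ c d [] [] = refl
carry-+ᵛ c d (a ∷ u) (b ∷ v) = carry-+ᵛ a b u v

shiftIn-0ᵛ : shiftIn false (0ᵛ {k}) ≡ 0ᵛ
shiftIn-0ᵛ {zero} = refl
shiftIn-0ᵛ {suc k} = cong (false ∷_) shiftIn-0ᵛ

carry-0ᵛ : carry false (0ᵛ {k}) ≡ false
carry-0ᵛ {zero} = refl
carry-0ᵛ {suc k} = carry-0ᵛ {k}

normCons : Bool → Poly → Poly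
normCons b [] = if b then true ∷ [] else []
normCons b (a ∷ q) = b ∷ a ∷ q

norm-∷ : ∀ b p → norm (b ∷ p) ≡ normCons b (norm p)
norm-∷ b p with norm p
... | [] = refl
... | a ∷ q = refl

-- The residue module F₂[x]/(x^k + c(x))

-- Z = x^k + c₀ + c₁x + … + c_{k-1}x^{k-1}
monic : Vec Bool k → Poly
monic c = toList c ∷ʳ true

1ᵛ : Vec Bool k
1ᵛ {zero} = []
1ᵛ {suc k} = true ∷ 0ᵛ

module Residue (c : Vec Bool k) where

  -- multiplication by x: the coefficient pushed past x^(k-1) comes back as c, since x^k ≡ c mod monic c
  x* : Vec Bool k → Vec Bool k
  x* r = shiftIn false r +ᵛ carry false r *ᵛ c

  x*-+ᵛ : (u v : Vec Bool k) → x* (u +ᵛ v) ≡ x* u +ᵛ x* v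
  x*-+ᵛ u v = begin
    shiftIn false (u +ᵛ v) +ᵛ carry false (u +ᵛ v) *ᵛ c
      ≡⟨ cong₂ _+ᵛ_ (shiftIn-+ᵛ false false u v)
                    (trans (cong (_*ᵛ c) (carry-+ᵛ false false u v))
                           (*ᵛ-distribʳ-xor (carry false u) (carry false v) c)) ⟩
    (shiftIn false u +ᵛ shiftIn false v) +ᵛ (carry false u *ᵛ c +ᵛ carry false v *ᵛ c)
      ≡⟨ +ᵛ-interchange _ _ _ _ ⟩
    x* u +ᵛ x* v ∎
    where open ≡-Reasoning

  x*-0ᵛ : x* 0ᵛ ≡ 0ᵛ
  x*-0ᵛ = trans (cong₂ _+ᵛ_ (shiftIn-0ᵛ {k}) (cong (_*ᵛ c) (carry-0ᵛ {k}))) 0ᵛ+ᵛ0ᵛ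

  x*-*ᵛ : ∀ a (u : Vec Bool k) → x* (a *ᵛ u) ≡ a *ᵛ x* u
  x*-*ᵛ true u = refl
  x*-*ᵛ false u = x*-0ᵛ

  infixr 7 _▷_

  _▷_ : Poly → Vec Bool k → Vec Bool k
  [] ▷ r = 0ᵛ
  (a ∷ p) ▷ r = a *ᵛ r +ᵛ x* (p ▷ r)

  reduce : Poly → Vec Bool k
  reduce p = p ▷ 1ᵛ

  ▷-zeroʳ : ∀ p → p ▷ 0ᵛ ≡ 0ᵛ
  ▷-zeroʳ [] = refl
  ▷-zeroʳ (a ∷ p) =
    trans (cong₂ _+ᵛ_ (*ᵛ-zeroʳ a) (trans (cong x* (▷-zeroʳ p)) x*-0ᵛ)) 0ᵛ+ᵛ0ᵛ

  ▷-+ᵛ : ∀ p (u v : Vec Bool k) → p ▷ (u +ᵛ v) ≡ p ▷ u +ᵛ p ▷ v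
  ▷-+ᵛ [] u v = sym 0ᵛ+ᵛ0ᵛ
  ▷-+ᵛ (a ∷ p) u v =
    trans (cong₂ _+ᵛ_ (*ᵛ-distribˡ-+ᵛ a u v) (trans (cong x* (▷-+ᵛ p u v)) (x*-+ᵛ _ _)))
          (+ᵛ-interchange (a *ᵛ u) (a *ᵛ v) _ _)

  ▷-*ᵛ : ∀ p a (r : Vec Bool k) → p ▷ (a *ᵛ r) ≡ a *ᵛ (p ▷ r)
  ▷-*ᵛ p true r = refl
  ▷-*ᵛ p false r = ▷-zeroʳ p

  ▷-x* : ∀ p (r : Vec Bool k) → p ▷ x* r ≡ x* (p ▷ r)
  ▷-x* [] r = sym x*-0ᵛ
  ▷-x* (a ∷ p) r =
    trans (cong₂ _+ᵛ_ (sym (x*-*ᵛ a r)) (cong x* (▷-x* p r)))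
          (sym (x*-+ᵛ (a *ᵛ r) (x* (p ▷ r))))

  ▷-⊕ : ∀ p q (r : Vec Bool k) → (p ⊕ q) ▷ r ≡ p ▷ r +ᵛ q ▷ r
  ▷-⊕ [] q r = sym (+ᵛ-identityˡ _)
  ▷-⊕ (a ∷ p) [] r = sym (+ᵛ-identityʳ _)
  ▷-⊕ (a ∷ p) (b ∷ q) r =
    trans (cong₂ _+ᵛ_ (*ᵛ-distribʳ-xor a b r) (trans (cong x* (▷-⊕ p q r)) (x*-+ᵛ _ _)))
          (+ᵛ-interchange (a *ᵛ r) (b *ᵛ r) _ _)

  ▷-scale : ∀ a q (r : Vec Bool k) → scale a q ▷ r ≡ a *ᵛ (q ▷ r)
  ▷-scale a [] r = sym (*ᵛ-zeroʳ a)
  ▷-scale true (b ∷ q) r = cong (λ s → b *ᵛ r +ᵛ x* s) (▷-scale true q r)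
  ▷-scale false (b ∷ q) r =
    trans (cong (λ s → 0ᵛ +ᵛ x* s) (▷-scale false q r)) (trans (+ᵛ-identityˡ _) x*-0ᵛ)

  ▷-⊗ : ∀ p q (r : Vec Bool k) → (p ⊗ q) ▷ r ≡ p ▷ q ▷ r
  ▷-⊗ [] q r = refl
  ▷-⊗ (a ∷ p) q r =
    trans (▷-⊕ (scale a q) (false ∷ (p ⊗ q)) r)
          (cong₂ _+ᵛ_ (▷-scale a q r) (trans (+ᵛ-identityˡ _) (cong x* (▷-⊗ p q r))))

  ▷-comm : ∀ p q (r : Vec Bool k) → p ▷ q ▷ r ≡ q ▷ p ▷ r
  ▷-comm [] q r = sym (▷-zeroʳ q)
  ▷-comm (a ∷ p) q r =
    trans (cong₂ _+ᵛ_ (sym (▷-*ᵛ q a r)) (trans (cong x* (▷-comm p q r)) (sym (▷-x* q (p ▷ r)))))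
          (sym (▷-+ᵛ q (a *ᵛ r) (x* (p ▷ r))))

  ▷-normCons : ∀ b q (r : Vec Bool k) → normCons b q ▷ r ≡ (b ∷ q) ▷ r
  ▷-normCons true [] r = refl
  ▷-normCons false [] r = sym (trans (+ᵛ-identityˡ _) x*-0ᵛ)
  ▷-normCons b (a ∷ q) r = refl

  ▷-norm : ∀ p (r : Vec Bool k) → norm p ▷ r ≡ p ▷ r
  ▷-norm [] r = refl
  ▷-norm (b ∷ p) r = begin
    norm (b ∷ p) ▷ r          ≡⟨ cong (_▷ r) (norm-∷ b p) ⟩
    normCons b (norm p) ▷ r   ≡⟨ ▷-normCons b (norm p) r ⟩
    (b ∷ norm p) ▷ r          ≡⟨ cong (λ s → b *ᵛ r +ᵛ x* s) (▷-norm p r) ⟩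
    (b ∷ p) ▷ r               ∎
    where open ≡-Reasoning

  reduce-≈ : ∀ p q → p ≈ q → reduce p ≡ reduce q
  reduce-≈ p q p≈q =
    trans (sym (▷-norm p 1ᵛ)) (trans (cong (_▷ 1ᵛ) p≈q) (▷-norm q 1ᵛ))

  reduce-⊗-zeroˡ : ∀ p q → reduce p ≡ 0ᵛ → reduce (p ⊗ q) ≡ 0ᵛ
  reduce-⊗-zeroˡ p q p≡0 = begin
    (p ⊗ q) ▷ 1ᵛ   ≡⟨ ▷-⊗ p q 1ᵛ ⟩
    p ▷ q ▷ 1ᵛ     ≡⟨ ▷-comm p q 1ᵛ ⟩
    q ▷ p ▷ 1ᵛ     ≡⟨ cong (q ▷_) p≡0 ⟩
    q ▷ 0ᵛ         ≡⟨ ▷-zeroʳ q ⟩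
    0ᵛ             ∎
    where open ≡-Reasoning

  reduce-⊗-zeroʳ : ∀ p q → reduce q ≡ 0ᵛ → reduce (p ⊗ q) ≡ 0ᵛ
  reduce-⊗-zeroʳ p q q≡0 = trans (▷-⊗ p q 1ᵛ) (trans (cong (p ▷_) q≡0) (▷-zeroʳ p))

open Residue using (reduce; reduce-≈; reduce-⊗-zeroˡ; reduce-⊗-zeroʳ)

infix 4 _≼_

_≼_ : Poly → Poly → Set
Z ≼ P = ∀ {k} (c : Vec Bool k) → reduce c Z ≡ 0ᵛ → reduce c P ≡ 0ᵛ

factorˡ-≼ : ∀ p q P → p ⊗ q ≈ P → p ≼ P
factorˡ-≼ p q P pq≈P c p≡0 = trans (sym (reduce-≈ c (p ⊗ q) P pq≈P)) (reduce-⊗-zeroˡ c p q p≡0)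

factorʳ-≼ : ∀ p q P → p ⊗ q ≈ P → q ≼ P
factorʳ-≼ p q P pq≈P c q≡0 = trans (sym (reduce-≈ c (p ⊗ q) P pq≈P)) (reduce-⊗-zeroʳ c p q q≡0)

-- Size (deg + 1, and 0 for the zero polynomial) and its additivity

consSize : Bool → ℕ → ℕ
consSize b zero = if b then 1 else 0
consSize b (suc n) = suc (suc n)

size : Poly → ℕ
size [] = 0
size (b ∷ p) = consSize b (size p)

length-normCons : ∀ b q → length (normCons b q) ≡ consSize b (length q)
length-normCons true [] = refl
length-normCons false [] = refl
length-normCons b (a ∷ q) = refl

length-norm : ∀ p → length (norm p) ≡ size p
length-norm [] = refl
length-norm (b ∷ p) = begin
  length (norm (b ∷ p))          ≡⟨ cong length (norm-∷ b p) ⟩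
  length (normCons b (norm p))   ≡⟨ length-normCons b (norm p) ⟩
  consSize b (length (norm p))   ≡⟨ cong (consSize b) (length-norm p) ⟩
  consSize b (size p)            ∎
  where open ≡-Reasoning

size-≈ : ∀ p q → p ≈ q → size p ≡ size q
size-≈ p q p≈q = trans (sym (length-norm p)) (trans (cong length p≈q) (length-norm q))

deg≡length-norm∸1 : ∀ p → deg p ≡ length (norm p) ∸ 1
deg≡length-norm∸1 p with norm p
... | [] = refl
... | a ∷ q = refl

deg≡size∸1 : ∀ p → deg p ≡ size p ∸ 1
deg≡size∸1 p = trans (deg≡length-norm∸1 p) (cong (_∸ 1) (length-norm p))

size≡suc-deg : ∀ p → 1 ≤ deg p → size p ≡ suc (deg p)
size≡suc-deg p 1≤deg with size p | deg≡size∸1 p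
... | zero | deg≡0 = ⊥-elim (n≮0 (subst (1 ≤_) deg≡0 1≤deg))
... | suc m | deg≡m = cong suc (sym deg≡m)

⊕-comm : ∀ u w → u ⊕ w ≡ w ⊕ u
⊕-comm [] [] = refl
⊕-comm [] (b ∷ w) = refl
⊕-comm (a ∷ u) [] = refl
⊕-comm (a ∷ u) (b ∷ w) = cong₂ _∷_ (xor-comm a b) (⊕-comm u w)

consSize≡0 : ∀ b n → consSize b n ≡ 0 → b ≡ false × n ≡ 0
consSize≡0 false zero _ = refl , refl

size-⊕-zeroʳ : ∀ u w → size w ≡ 0 → size (u ⊕ w) ≡ size u
size-⊕-zeroʳ [] w w≡0 = w≡0
size-⊕-zeroʳ (a ∷ u) [] _ = refl
size-⊕-zeroʳ (a ∷ u) (b ∷ w) bw≡0 with consSize≡0 b (size w) bw≡0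
... | refl , w≡0 = cong₂ consSize (xor-identityʳ a) (size-⊕-zeroʳ u w w≡0)

size-⊕-zeroˡ : ∀ u w → size u ≡ 0 → size (u ⊕ w) ≡ size w
size-⊕-zeroˡ u w u≡0 = trans (cong size (⊕-comm u w)) (size-⊕-zeroʳ w u u≡0)

size-∷-< : ∀ a b u → consSize a (size u) < consSize b (suc n) → size u < suc n
size-∷-< a b u lt with size u
... | zero = s≤s z≤n
... | suc m with lt
...   | s≤s (s≤s m<n) = s≤s m<n

size-⊕-<-const : ∀ a b u w → size w ≡ 0 → consSize a (size u) < consSize b 0 →
                 consSize (a xor b) (size (u ⊕ w)) ≡ consSize b 0
size-⊕-<-const a true u w w≡0 lt with consSize≡0 a (size u) (n<1⇒n≡0 lt)
... | refl , u≡0 = cong (consSize true) (trans (size-⊕-zeroʳ u w w≡0) u≡0)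

size-⊕-< : ∀ u w → size u < size w → size (u ⊕ w) ≡ size w
size-⊕-< [] w _ = refl
size-⊕-< (a ∷ u) (b ∷ w) lt with size w in w≡
... | zero = size-⊕-<-const a b u w w≡ lt
... | suc m = cong (consSize (a xor b))
  (trans (size-⊕-< u w (subst (size u <_) (sym w≡) (size-∷-< a b u lt))) w≡)

infixl 7 _⊛_

-- m ⊛ n is the size of a product of polynomials of sizes m and n
_⊛_ : ℕ → ℕ → ℕ
zero ⊛ n = zero
suc m ⊛ zero = zero
suc m ⊛ suc n = suc (m + n)

⊛-zeroʳ : ∀ m → m ⊛ 0 ≡ 0
⊛-zeroʳ zero = refl
⊛-zeroʳ (suc m) = refl

consSize-false-⊛ : ∀ m n → consSize false (m ⊛ n) ≡ consSize false m ⊛ n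
consSize-false-⊛ zero n = refl
consSize-false-⊛ (suc m) zero = refl
consSize-false-⊛ (suc m) (suc n) = refl

size-scale-true : ∀ q → size (scale true q) ≡ size q
size-scale-true q = cong size (map-id q)

size-scale-false : ∀ q → size (scale false q) ≡ 0
size-scale-false [] = refl
size-scale-false (b ∷ q) = cong (consSize false) (size-scale-false q)

size-⊗ : ∀ p q → size (p ⊗ q) ≡ size p ⊛ size q
size-⊗ [] q = refl
size-⊗ (false ∷ p) q = begin
  size (scale false q ⊕ (false ∷ p ⊗ q))  ≡⟨ size-⊕-zeroˡ (scale false q) _ (size-scale-false q) ⟩
  consSize false (size (p ⊗ q))           ≡⟨ cong (consSize false) (size-⊗ p q) ⟩
  consSize false (size p ⊛ size q)        ≡⟨ consSize-false-⊛ (size p) (size q) ⟩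
  consSize false (size p) ⊛ size q        ∎
  where open ≡-Reasoning
size-⊗ (true ∷ p) q with size q in q≡ | size p in p≡ | size-⊗ p q
... | zero | m | pq≡ =
  trans (size-⊕-zeroʳ (scale true q) _ (cong (consSize false) (trans pq≡ (⊛-zeroʳ m))))
        (trans (size-scale-true q) (trans q≡ (sym (⊛-zeroʳ (consSize true m)))))
... | suc n | zero | pq≡ =
  trans (size-⊕-zeroʳ (scale true q) _ (cong (consSize false) pq≡))
        (trans (size-scale-true q) q≡)
... | suc n | suc m | pq≡ = trans (size-⊕-< (scale true q) _ shorter) (cong (consSize false) pq≡)
  where
  shorter : size (scale true q) < consSize false (size (p ⊗ q))
  shorter rewrite size-scale-true q | q≡ | pq≡ = s≤s (s≤s (m≤n+m n m))

⊛≡suc : ∀ m n {d} → m ⊛ n ≡ suc d → (m ∸ 1) + (n ∸ 1) ≡ d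
⊛≡suc (suc m) (suc n) eq = suc-injective eq

deg-⊗ : ∀ p q P → p ⊗ q ≈ P → 1 ≤ deg P → deg p + deg q ≡ deg P
deg-⊗ p q P pq≈P 1≤deg = begin
  deg p + deg q                ≡⟨ cong₂ _+_ (deg≡size∸1 p) (deg≡size∸1 q) ⟩
  (size p ∸ 1) + (size q ∸ 1)  ≡⟨ ⊛≡suc (size p) (size q) size-pq ⟩
  deg P                        ∎
  where
  open ≡-Reasoning
  size-pq : size p ⊛ size q ≡ suc (deg P)
  size-pq = trans (sym (size-⊗ p q)) (trans (size-≈ (p ⊗ q) P pq≈P) (size≡suc-deg P 1≤deg))

normCons-∷ʳ-true : ∀ b l → normCons b (l ∷ʳ true) ≡ b ∷ l ∷ʳ true
normCons-∷ʳ-true b [] = refl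
normCons-∷ʳ-true b (a ∷ l) = refl

norm-∷ʳ-true : ∀ l → norm (l ∷ʳ true) ≡ l ∷ʳ true
norm-∷ʳ-true [] = refl
norm-∷ʳ-true (b ∷ l) =
  trans (norm-∷ b (l ∷ʳ true)) (trans (cong (normCons b) (norm-∷ʳ-true l)) (normCons-∷ʳ-true b l))

norm-[]-or-∷ʳ-true : ∀ p → norm p ≡ [] ⊎ ∃ λ l → norm p ≡ l ∷ʳ true
norm-[]-or-∷ʳ-true [] = inj₁ refl
norm-[]-or-∷ʳ-true (b ∷ p) with norm-[]-or-∷ʳ-true p
... | inj₂ (l , p≡) = inj₂ (b ∷ l , trans (norm-∷ b p) (trans (cong (normCons b) p≡) (normCons-∷ʳ-true b l)))
... | inj₁ p≡ with b
...   | true = inj₂ ([] , trans (norm-∷ true p) (cong (normCons true) p≡))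
...   | false = inj₁ (trans (norm-∷ false p) (cong (normCons false) p≡))

deg-∷ʳ-true : ∀ p l → norm p ≡ l ∷ʳ true → deg p ≡ length l
deg-∷ʳ-true p l norm≡ = begin
  deg p                       ≡⟨ deg≡length-norm∸1 p ⟩
  length (norm p) ∸ 1         ≡⟨ cong (λ q → length q ∸ 1) norm≡ ⟩
  length (l ∷ʳ true) ∸ 1      ≡⟨ cong (_∸ 1) (length-++ l) ⟩
  length l + 1 ∸ 1            ≡⟨ m+n∸n≡m (length l) 1 ⟩
  length l                    ∎
  where open ≡-Reasoning

_≟ᵛ_ : (u v : Vec Bool k) → Dec (u ≡ v)
_≟ᵛ_ = Vec.≡-dec Bool._≟_

all-Vec? : {Q : Vec Bool k → Set} → (∀ v → Dec (Q v)) → Dec (∀ v → Q v)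
all-Vec? {zero} Q? = map′ (λ { q [] → q }) (λ f → f []) (Q? [])
all-Vec? {suc k} Q? =
  map′ (λ { (f , t) (false ∷ v) → f v ; (f , t) (true ∷ v) → t v })
       (λ g → g ∘ (false ∷_) , g ∘ (true ∷_))
       (all-Vec? (Q? ∘ (false ∷_)) ×-dec all-Vec? (Q? ∘ (true ∷_)))

-- The first component holds for every c; it is decided rather than proved.
Excludes : Poly → Vec Bool k → Set
Excludes P c = reduce c (monic c) ≡ 0ᵛ × reduce c P ≢ 0ᵛ

excludes? : ∀ P (c : Vec Bool k) → Dec (Excludes P c)
excludes? P c = (reduce c (monic c) ≟ᵛ 0ᵛ) ×-dec ¬? (reduce c P ≟ᵛ 0ᵛ)

NoMonicFactorUpTo : ℕ → Poly → Set
NoMonicFactorUpTo b P = ∀ {k} → k < b → (c : Vec Bool (suc k)) → Excludes P c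

noMonicFactorUpTo? : ∀ b P → Dec (NoMonicFactorUpTo b P)
noMonicFactorUpTo? b P = allUpTo? (λ k → all-Vec? (excludes? P)) b

NoMonicFactorUpTo⇒⋡ : ∀ {b} P → NoMonicFactorUpTo b P →
                      ∀ Z → 1 ≤ deg Z → deg Z ≤ b → ¬ Z ≼ P
NoMonicFactorUpTo⇒⋡ {b} P none Z 1≤deg deg≤b Z≼P with norm-[]-or-∷ʳ-true Z
... | inj₁ Z≡[] = n≮0 (subst (1 ≤_) (trans (deg≡length-norm∸1 Z) (cong (λ q → length q ∸ 1) Z≡[])) 1≤deg)
... | inj₂ ([] , Z≡) = n≮0 (subst (1 ≤_) (deg-∷ʳ-true Z [] Z≡) 1≤deg)
... | inj₂ (l@(_ ∷ _) , Z≡) = proj₂ excluded (Z≼P c Z↦0)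
  where
  c : Vec Bool (length l)
  c = fromList l
  excluded : Excludes P c
  excluded = none (subst (_≤ b) (deg-∷ʳ-true Z l Z≡) deg≤b) c
  Z≈monic : Z ≈ monic c
  Z≈monic = trans Z≡ (sym (trans (cong (λ l → norm (l ∷ʳ true)) (toList∘fromList l)) (norm-∷ʳ-true l)))
  Z↦0 : reduce c Z ≡ 0ᵛ
  Z↦0 = trans (reduce-≈ c Z (monic c) Z≈monic) (proj₁ excluded)

half-of-smaller : ∀ d e → d ≤ e → d ≤ ⌊ d + e /2⌋
half-of-smaller d e d≤e = subst (_≤ ⌊ d + e /2⌋) (sym (n≡⌊n+n/2⌋ d)) (⌊n/2⌋-mono (+-monoʳ-≤ d d≤e))

irreducible-by-search : ∀ P → 1 ≤ deg P → NoMonicFactorUpTo ⌊ deg P /2⌋ P → Irreducible P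
irreducible-by-search P 1≤deg none = 1≤deg , divisor-degree
  where
  no-smaller-factor : ∀ Z m n → deg Z ≡ suc m → suc m + suc n ≡ deg P → m ≤ n → ¬ Z ≼ P
  no-smaller-factor Z m n Z≡ m+n≡ m≤n =
    NoMonicFactorUpTo⇒⋡ P none Z
      (subst (1 ≤_) (sym Z≡) (s≤s z≤n))
      (subst₂ _≤_ (sym Z≡) (cong ⌊_/2⌋ m+n≡) (half-of-smaller (suc m) (suc n) (s≤s m≤n)))
  divisor-degree : ∀ D → D ∣ P → deg D ≡ 0 ⊎ deg D ≡ deg P
  divisor-degree D (Q , DQ≈P) with deg D in D≡ | deg Q in Q≡ | deg-⊗ D Q P DQ≈P 1≤deg
  ... | zero | _ | _ = inj₁ refl
  ... | suc d | zero | d+0≡ = inj₂ (trans (sym (+-identityʳ (suc d))) d+0≡)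
  ... | suc d | suc e | d+e≡ with ≤-total d e
  ...   | inj₁ d≤e = ⊥-elim (no-smaller-factor D d e D≡ d+e≡ d≤e (factorˡ-≼ D Q P DQ≈P))
  ...   | inj₂ e≤d = ⊥-elim (no-smaller-factor Q e d Q≡ (trans (+-comm (suc e) (suc d)) d+e≡) e≤d
                                                 (factorʳ-≼ D Q P DQ≈P))

odd-by-reduction : ∀ P → reduce (false ∷ []) P ≢ 0ᵛ → reduce (true ∷ []) P ≢ 0ᵛ → Odd P
odd-by-reduction P P≢0-mod-x P≢0-mod-x+1 =
    (λ { (Q , XQ≈P) → P≢0-mod-x (factorˡ-≼ X Q P XQ≈P (false ∷ []) refl) })
  , (λ { (Q , X1Q≈P) → P≢0-mod-x+1 (factorˡ-≼ X1 Q P X1Q≈P (true ∷ []) refl) })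

OddIrreducibleCertificate : Poly → Set
OddIrreducibleCertificate P =
  1 ≤ deg P × NoMonicFactorUpTo ⌊ deg P /2⌋ P × reduce (false ∷ []) P ≢ 0ᵛ × reduce (true ∷ []) P ≢ 0ᵛ

oddIrreducibleCertificate? : ∀ P → Dec (OddIrreducibleCertificate P)
oddIrreducibleCertificate? P =
  1 ≤? deg P ×-dec noMonicFactorUpTo? ⌊ deg P /2⌋ P
             ×-dec ¬? (reduce (false ∷ []) P ≟ᵛ 0ᵛ) ×-dec ¬? (reduce (true ∷ []) P ≟ᵛ 0ᵛ)

certificate⇒odd-irreducible : ∀ P → OddIrreducibleCertificate P → Irreducible P × Odd P
certificate⇒odd-irreducible P (1≤deg , none , mod-x , mod-x+1) =
  irreducible-by-search P 1≤deg none , odd-by-reduction P mod-x mod-x+1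

_∈ᶠ?_ : ∀ P G → Dec (P ∈ᶠ G)
P ∈ᶠ? G = any? (λ Q → List.≡-dec Bool._≟_ (norm P) (norm Q)) G

lemma3p5 : Admissible 𝓕
lemma3p5 = All.map (λ {P} → certificate⇒odd-irreducible P) (from-yes (all? oddIrreducibleCertificate? 𝓕))
         , inj₁ (from-yes (all? (λ T → rec* T ∈ᶠ? 𝓕 ⊎-dec bar T ∈ᶠ? 𝓕) 𝓕))
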